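{- For every $n\ge0$ and every $v\in\{0,1\}^n$, $$f_v(q,a,t)=\sum_{\substack{\gamma\in\mathbb{N}^n\\ \gamma_i=0\iff v_i=1}} q^{\operatorname{area}(\gamma)}\prod_{i=1}^n\left(a+t^{\operatorname{dinv}_i(\gamma)}\right),$$ where $\operatorname{area}(\gamma)=|\gamma|-\#\{1\le i\le n:\gamma_i>0\}$ and $\operatorname{dinv}_i(\gamma)=\#\{j<i:\gamma_j=\gamma_i\}+\#\{j>i:\gamma_j=\gamma_i+1\}$.
   Context: $\mathbb{N}=\{0,1,2,\dots\}$ and $|\gamma|=\gamma_1+\dots+\gamma_n$. The series $f_v(q,a,t)$ (the regraded Poincaré series of the triply graded homology of a complex attached to $v$ by Elias and Hogancamp) are defined by the following recurrence. For a binary word $v$ let $|v|$ be its number of $1$'s. Given $v\in\{0,1\}^n$ and $w\in\{0,1\}^{n-|v|}$, form $u\in\{0,1,2\}^n$ by: $u_i=1$ if $v_i=1$; if $v_i=0$ and this is the $j$-th zero of $v$ from the left, $u_i=2w_j$. Let $P_{v,w}(a,t)=\prod_{i:\,v_i=1}\left(t^{\#\{j<i:\,u_j=1\}+\#\{j>i:\,u_j=2\}}+a\right)$. Then $f_\emptyset=1$; for $n\ge1$, $f_{0^n}=(1-q)^{ -1}f_{10^{n-1}}$ with $(1-q)^{ -1}=\sum_{k\ge0}q^k$; and for $v\ne0^n$, $f_v=\sum_{w\in\{0,1\}^{n-|v|}}q^{n-|v|-|w|}P_{v,w}(a,t)f_w$. -}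

module Defs where

open import Data.Nat using (ℕ; zero; suc; _+_; _*_; _∸_; _≡ᵇ_)
open import Data.Bool using (Bool; true; false; if_then_else_; _∧_; not)
open import Data.List using (List; []; _∷_; [_]; map; foldr; concatMap; replicate; length; upTo)
open import Data.Nat.ListAction using (sum)

-- Formal power series in q, a, t with ℕ coefficients.
-- S k i j = coefficient of q^k a^i t^j.

Series : Set
Series = ℕ → ℕ → ℕ → ℕ

Σ≤ : ℕ → (ℕ → ℕ) → ℕ
Σ≤ zero    f = f 0
Σ≤ (suc n) f = Σ≤ n f + f (suc n)

δ : ℕ → ℕ → ℕ
δ zero    zero    = 1
δ zero    (suc _) = 0
δ (suc _) zero    = 0
δ (suc m) (suc n) = δ m n

mono : ℕ → ℕ → ℕ → Series
mono k i j k' i' j' = δ k k' * δ i i' * δ j j'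

0S 1S : Series
0S _ _ _ = 0
1S = mono 0 0 0

infixl 6 _⊕_
infixl 7 _⊗_

_⊕_ : Series → Series → Series
(S ⊕ T) k i j = S k i j + T k i j

_⊗_ : Series → Series → Series
(S ⊗ T) k i j =
  Σ≤ k λ k' → Σ≤ i λ i' → Σ≤ j λ j' → S k' i' j' * T (k ∸ k') (i ∸ i') (j ∸ j')

qS : ℕ → Series
qS m = mono m 0 0

aS : Series
aS = mono 0 1 0

tS : ℕ → Series
tS m = mono 0 0 m

-- (1 - q)^{-1} = Σ_{k ≥ 0} q^k
geom : Series
geom k i j = δ i 0 * δ j 0

ΣL : {A : Set} → List A → (A → Series) → Series
ΣL xs F = foldr (λ x S → F x ⊕ S) 0S xs

ΠS : List Series → Series
ΠS = foldr _⊗_ 1S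

-- Binary words (as lists of Bool; true = 1, false = 0)

count : {A : Set} → (A → Bool) → List A → ℕ
count p []       = 0
count p (x ∷ xs) = if p x then suc (count p xs) else count p xs

ones : List Bool → ℕ
ones = count (λ b → b)

allZero : List Bool → Bool
allZero []       = true
allZero (b ∷ bs) = not b ∧ allZero bs

allWords : ℕ → List (List Bool)
allWords zero    = [ [] ]
allWords (suc m) = concatMap (λ w → (false ∷ w) ∷ (true ∷ w) ∷ []) (allWords m)

-- the word u ∈ {0,1,2}^n built from v and w
merge : List Bool → List Bool → List ℕ
merge []          _       = []
merge (true ∷ v)  w       = 1 ∷ merge v w
merge (false ∷ v) []      = 0 ∷ merge v []          -- not reached when |w| = n - |v|
merge (false ∷ v) (b ∷ w) = (if b then 2 else 0) ∷ merge v w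

-- factors (t^{#{j<i : u_j=1} + #{j>i : u_j=2}} + a) for the i with u_i = 1;
-- c = number of 1's of u seen so far (to the left)
Pfactors : ℕ → List ℕ → List Series
Pfactors c []      = []
Pfactors c (x ∷ u) =
  if x ≡ᵇ 1
  then (tS (c + count (λ y → y ≡ᵇ 2) u) ⊕ aS) ∷ Pfactors (suc c) u
  else Pfactors c u

P : List Bool → List Bool → Series
P v w = ΠS (Pfactors 0 (merge v w))

-- The recurrence, with a fuel argument (each call decreases the fuel).
-- Fuel 2n+1 suffices for a word of length n.
fAux : ℕ → List Bool → Series
fAux zero       _       = 0S
fAux (suc fuel) []      = 1S
fAux (suc fuel) (b ∷ v) =
  if allZero (b ∷ v)
  then geom ⊗ fAux fuel (true ∷ replicate (length v) false)
  else ΣL (allWords (suc (length v) ∸ ones (b ∷ v))) λ w →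
         qS (suc (length v) ∸ ones (b ∷ v) ∸ ones w) ⊗ P (b ∷ v) w ⊗ fAux fuel w

f : List Bool → Series
f v = fAux (suc (2 * length v)) v

compat : List Bool → List ℕ → Bool
compat []      []      = true
compat (b ∷ v) (g ∷ γ) = (if b then g ≡ᵇ 0 else not (g ≡ᵇ 0)) ∧ compat v γ
compat _       _       = false

area : List ℕ → ℕ
area γ = sum γ ∸ count (λ g → not (g ≡ᵇ 0)) γ

-- the list (dinv_1(γ), ..., dinv_n(γ)); first argument = entries to the left
dinvs : List ℕ → List ℕ → List ℕ
dinvs before []      = []
dinvs before (g ∷ γ) =
  (count (λ x → x ≡ᵇ g) before + count (λ x → x ≡ᵇ suc g) γ) ∷ dinvs (g ∷ before) γ

term : List ℕ → Series
term γ = qS (area γ) ⊗ ΠS (map (λ d → aS ⊕ tS d) (dinvs [] γ))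

box : ℕ → ℕ → List (List ℕ)
box B zero    = [ [] ]
box B (suc n) = concatMap (λ x → map (x ∷_) (box B n)) (upTo (suc B))

-- coefficient of q^k a^i t^j in Σ_{γ ∈ ℕ^n, γ_i = 0 ⇔ v_i = 1} term γ.
-- Only γ with all entries ≤ k+1 can contribute to q^k (area γ ≥ γ_i - 1),
-- so the sum is restricted to the box {0,...,k+1}^n.
rhsCoeff : List Bool → ℕ → ℕ → ℕ → ℕ
rhsCoeff v k i j =
  ΣL (box (suc k) (length v)) (λ γ → if compat v γ then term γ else 0S) k i j

-- Write G v for the right-hand side. A γ compatible with v is lift v γ′, where γ′ lists the entries of γ at the
-- zeros of v lowered by one; let w mark the zeros of γ′. Then area γ = |γ′| exceeds area γ′ by the number of
-- nonzero entries of γ′, the dinvs at the zeros of v are those of γ′, and at a one of v the dinv counts the 0's of γ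
-- before it and the 1's after it, that is the 1's of u before it and the 2's after it. So the term of γ is
-- q^(n - |v| - |w|) P_{v,w} times the term of γ′, and grouping the γ′ by w shows that G satisfies the recurrence
-- of f. For v = 0ⁿ that recurrence is circular; instead, moving the last entry g of γ to the front as g - 1 keeps
-- all dinvs and lowers the area by one unless g = 1, so G 0ⁿ = G 10ⁿ⁻¹ + q G 0ⁿ, i.e. G 0ⁿ = G 10ⁿ⁻¹ / (1 - q).
-- The infinite sum over γ is handled through boxes, which are exact in each q-degree since the term of γ has
-- q-degree at least max γ - 1, and the series ring ℕ[[q,a,t]] is a threefold convolution semiring over ℕ.

module Submission where

open import Level using (0ℓ)
open import Algebra.Bundles using (CommutativeSemiring)
open import Algebra.Core using (Op₂)
open import Algebra.Structures using (IsCommutativeSemiring)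
import Data.Nat.Base as ℕ
open ℕ using (ℕ; zero; suc; pred; s≤s⁻¹; _∸_; _≤_; _≤′_; ≤′-refl; ≤′-step; z≤n; s≤s)
open import Data.Nat.Properties using (≤-refl; ≤-trans; n≤1+n; n∸n≡0; m∸[m∸n]≡n; +-∸-assoc)
open import Data.Product using (_,_)
import Relation.Binary.Reasoning.Setoid
import Relation.Binary.PropositionalEquality as ≡
open ≡ using (_≡_; module ≡-Reasoning)

-- Convolution semirings

module _ {c ℓ} (R : CommutativeSemiring c ℓ) where

  open CommutativeSemiring R
  open import Relation.Binary.Reasoning.Setoid setoid

  isCommutativeSemiring-replace : (_*′_ : Op₂ Carrier) (1′ : Carrier) →
    (∀ x y → x *′ y ≈ x * y) → 1′ ≈ 1# → IsCommutativeSemiring _≈_ _+_ _*′_ 0# 1′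
  isCommutativeSemiring-replace _*′_ 1′ *′≈* 1′≈1 = record
    { isSemiring = record
      { isSemiringWithoutAnnihilatingZero = record
        { +-isCommutativeMonoid = +-isCommutativeMonoid
        ; *-cong = λ {x} {x′} {y} {y′} x≈x′ y≈y′ → begin
            x *′ y   ≈⟨ *′≈* x y ⟩
            x * y    ≈⟨ *-cong x≈x′ y≈y′ ⟩
            x′ * y′  ≈⟨ *′≈* x′ y′ ⟨
            x′ *′ y′ ∎
        ; *-assoc = λ x y z → begin
            (x *′ y) *′ z ≈⟨ *′≈* _ z ⟩
            (x *′ y) * z  ≈⟨ *-congʳ (*′≈* x y) ⟩
            (x * y) * z   ≈⟨ *-assoc x y z ⟩
            x * (y * z)   ≈⟨ *-congˡ (*′≈* y z) ⟨
            x * (y *′ z)  ≈⟨ *′≈* x _ ⟨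
            x *′ (y *′ z) ∎
        ; *-identity = (λ x → trans (*′≈* 1′ x) (trans (*-congʳ 1′≈1) (*-identityˡ x)))
                     , (λ x → trans (*′≈* x 1′) (trans (*-congˡ 1′≈1) (*-identityʳ x)))
        ; distrib = (λ x y z → trans (*′≈* x _) (trans (distribˡ x y z) (sym (+-cong (*′≈* x y) (*′≈* x z)))))
                  , (λ x y z → trans (*′≈* _ x) (trans (distribʳ x y z) (sym (+-cong (*′≈* y x) (*′≈* z x)))))
        }
      ; zero = (λ x → trans (*′≈* 0# x) (zeroˡ x)) , (λ x → trans (*′≈* x 0#) (zeroʳ x))
      }
    ; *-comm = λ x y → trans (*′≈* x y) (trans (*-comm x y) (sym (*′≈* y x)))
    }

module Convolution {c ℓ} (R : CommutativeSemiring c ℓ) where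

  open CommutativeSemiring R
  open import Relation.Binary.Reasoning.Setoid setoid
  open import Algebra.Properties.CommutativeSemigroup +-commutativeSemigroup using (interchange)
  import Algebra.Construct.Pointwise ℕ as Pointwise

  Seq : Set c
  Seq = ℕ → Carrier

  sumTo : ℕ → Seq → Carrier
  sumTo zero    f = f 0
  sumTo (suc n) f = sumTo n f + f (suc n)

  infixl 7 _⋆_
  infix 8 x^_

  _⋆_ : Seq → Seq → Seq
  (f ⋆ g) n = sumTo n λ m → f m * g (n ∸ m)

  x^_ : ℕ → Seq
  (x^ zero)  zero    = 1#
  (x^ zero)  (suc _) = 0#
  (x^ suc m) zero    = 0#
  (x^ suc m) (suc n) = (x^ m) n

  sumTo-cong : ∀ n {f g} → (∀ m → m ≤ n → f m ≈ g m) → sumTo n f ≈ sumTo n g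
  sumTo-cong zero    f≈g = f≈g 0 z≤n
  sumTo-cong (suc n) f≈g =
    +-cong (sumTo-cong n λ m m≤n → f≈g m (≤-trans m≤n (n≤1+n n))) (f≈g (suc n) ≤-refl)

  sumTo-+ : ∀ n f g → sumTo n (λ m → f m + g m) ≈ sumTo n f + sumTo n g
  sumTo-+ zero    f g = refl
  sumTo-+ (suc n) f g = trans (+-congʳ (sumTo-+ n f g)) (interchange _ _ _ _)

  sumTo-*ˡ : ∀ n x f → x * sumTo n f ≈ sumTo n (λ m → x * f m)
  sumTo-*ˡ zero    x f = refl
  sumTo-*ˡ (suc n) x f = trans (distribˡ x _ _) (+-congʳ (sumTo-*ˡ n x f))

  sumTo-*ʳ : ∀ n x f → sumTo n f * x ≈ sumTo n (λ m → f m * x)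
  sumTo-*ʳ zero    x f = refl
  sumTo-*ʳ (suc n) x f = trans (distribʳ x _ _) (+-congʳ (sumTo-*ʳ n x f))

  sumTo-0 : ∀ n → sumTo n (λ _ → 0#) ≈ 0#
  sumTo-0 zero    = refl
  sumTo-0 (suc n) = trans (+-identityʳ _) (sumTo-0 n)

  sumTo-head : ∀ n f → sumTo (suc n) f ≈ f 0 + sumTo n (λ m → f (suc m))
  sumTo-head zero    f = refl
  sumTo-head (suc n) f = trans (+-congʳ (sumTo-head n f)) (+-assoc _ _ _)

  sumTo-reverse : ∀ n f → sumTo n f ≈ sumTo n (λ m → f (n ∸ m))
  sumTo-reverse zero    f = refl
  sumTo-reverse (suc n) f = begin
    sumTo n f + f (suc n)                  ≈⟨ +-comm _ _ ⟩
    f (suc n) + sumTo n f                  ≈⟨ +-congˡ (sumTo-reverse n f) ⟩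
    f (suc n) + sumTo n (λ m → f (n ∸ m))  ≈⟨ sumTo-head n (λ m → f (suc n ∸ m)) ⟨
    sumTo (suc n) (λ m → f (suc n ∸ m))    ∎

  sumTo-triangle : ∀ n (F : ℕ → Seq) →
    sumTo n (λ a → sumTo (n ∸ a) (F a)) ≈ sumTo n (λ c → sumTo c (λ a → F a (c ∸ a)))
  sumTo-triangle zero    F = refl
  sumTo-triangle (suc n) F = begin
    sumTo n (λ a → sumTo (suc n ∸ a) (F a)) + sumTo (n ∸ n) (F (suc n))
      ≈⟨ +-cong (sumTo-cong n row) (reflexive (≡.cong (λ m → sumTo m (F (suc n))) (n∸n≡0 n))) ⟩
    sumTo n (λ a → sumTo (n ∸ a) (F a) + F a (suc n ∸ a)) + F (suc n) 0
      ≈⟨ +-congʳ (sumTo-+ n _ _) ⟩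
    (sumTo n (λ a → sumTo (n ∸ a) (F a)) + sumTo n (λ a → F a (suc n ∸ a))) + F (suc n) 0
      ≈⟨ +-assoc _ _ _ ⟩
    sumTo n (λ a → sumTo (n ∸ a) (F a)) + (sumTo n (λ a → F a (suc n ∸ a)) + F (suc n) 0)
      ≈⟨ +-cong (sumTo-triangle n F) (+-congˡ (reflexive (≡.cong (F (suc n)) (≡.sym (n∸n≡0 n))))) ⟩
    sumTo n (λ c → sumTo c (λ a → F a (c ∸ a))) + sumTo (suc n) (λ a → F a (suc n ∸ a)) ∎
    where
    row : ∀ a → a ≤ n → sumTo (suc n ∸ a) (F a) ≈ sumTo (n ∸ a) (F a) + F a (suc n ∸ a)
    row a a≤n rewrite +-∸-assoc 1 a≤n = refl

  ⋆-cong : ∀ {f f′ g g′} → (∀ n → f n ≈ f′ n) → (∀ n → g n ≈ g′ n) →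
           ∀ n → (f ⋆ g) n ≈ (f′ ⋆ g′) n
  ⋆-cong f≈f′ g≈g′ n = sumTo-cong n λ m _ → *-cong (f≈f′ m) (g≈g′ (n ∸ m))

  ⋆-comm : ∀ f g n → (f ⋆ g) n ≈ (g ⋆ f) n
  ⋆-comm f g n = begin
    sumTo n (λ m → f m * g (n ∸ m))              ≈⟨ sumTo-reverse n _ ⟩
    sumTo n (λ m → f (n ∸ m) * g (n ∸ (n ∸ m)))  ≈⟨ sumTo-cong n swap ⟩
    sumTo n (λ m → g m * f (n ∸ m))              ∎
    where
    swap : ∀ m → m ≤ n → f (n ∸ m) * g (n ∸ (n ∸ m)) ≈ g m * f (n ∸ m)
    swap m m≤n rewrite m∸[m∸n]≡n m≤n = *-comm _ _

  ⋆-assoc : ∀ f g h n → ((f ⋆ g) ⋆ h) n ≈ (f ⋆ (g ⋆ h)) n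
  ⋆-assoc f g h n = begin
    sumTo n (λ c → sumTo c (λ a → f a * g (c ∸ a)) * h (n ∸ c))
      ≈⟨ sumTo-cong n (λ c _ → sumTo-*ʳ c (h (n ∸ c)) _) ⟩
    sumTo n (λ c → sumTo c (λ a → f a * g (c ∸ a) * h (n ∸ c)))
      ≈⟨ sumTo-cong n (λ c c≤n → sumTo-cong c λ a a≤c → reassoc a c a≤c c≤n) ⟩
    sumTo n (λ c → sumTo c (λ a → f a * (g (c ∸ a) * h (n ∸ a ∸ (c ∸ a)))))
      ≈⟨ sumTo-triangle n (λ a b → f a * (g b * h (n ∸ a ∸ b))) ⟨
    sumTo n (λ a → sumTo (n ∸ a) (λ b → f a * (g b * h (n ∸ a ∸ b))))
      ≈⟨ sumTo-cong n (λ a _ → sumTo-*ˡ (n ∸ a) (f a) _) ⟨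
    sumTo n (λ a → f a * sumTo (n ∸ a) (λ b → g b * h (n ∸ a ∸ b))) ∎
    where
    ∸-∸ : ∀ a c n → a ≤ c → c ≤ n → n ∸ a ∸ (c ∸ a) ≡ n ∸ c
    ∸-∸ zero    c       n       _         _         = ≡.refl
    ∸-∸ (suc a) (suc c) (suc n) (s≤s a≤c) (s≤s c≤n) = ∸-∸ a c n a≤c c≤n
    reassoc : ∀ a c → a ≤ c → c ≤ n →
      f a * g (c ∸ a) * h (n ∸ c) ≈ f a * (g (c ∸ a) * h (n ∸ a ∸ (c ∸ a)))
    reassoc a c a≤c c≤n rewrite ∸-∸ a c n a≤c c≤n = *-assoc _ _ _

  x^0-⋆ : ∀ f n → (x^ 0 ⋆ f) n ≈ f n
  x^0-⋆ f zero    = *-identityˡ _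
  x^0-⋆ f (suc n) = begin
    sumTo (suc n) (λ m → (x^ 0) m * f (suc n ∸ m))
      ≈⟨ sumTo-head n _ ⟩
    1# * f (suc n) + sumTo n (λ m → 0# * f (n ∸ m))
      ≈⟨ +-cong (*-identityˡ _) (trans (sumTo-cong n λ m _ → zeroˡ _) (sumTo-0 n)) ⟩
    f (suc n) + 0#
      ≈⟨ +-identityʳ _ ⟩
    f (suc n) ∎

  convolution : CommutativeSemiring c ℓ
  convolution = record
    { Carrier = Seq
    ; _≈_ = λ f g → ∀ n → f n ≈ g n
    ; _+_ = λ f g n → f n + g n
    ; _*_ = _⋆_
    ; 0# = λ _ → 0#
    ; 1# = x^ 0
    ; isCommutativeSemiring = record
      { isSemiring = record
        { isSemiringWithoutAnnihilatingZero = record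
          { +-isCommutativeMonoid = Pointwise.isCommutativeMonoid +-isCommutativeMonoid
          ; *-cong = ⋆-cong
          ; *-assoc = ⋆-assoc
          ; *-identity = x^0-⋆ , (λ f n → trans (⋆-comm f (x^ 0) n) (x^0-⋆ f n))
          ; distrib = (λ f g h n → trans (sumTo-cong n λ m _ → distribˡ _ _ _) (sumTo-+ n _ _))
                    , (λ f g h n → trans (sumTo-cong n λ m _ → distribʳ _ _ _) (sumTo-+ n _ _))
          }
        ; zero = (λ f n → trans (sumTo-cong n λ m _ → zeroˡ _) (sumTo-0 n))
               , (λ f n → trans (sumTo-cong n λ m _ → zeroʳ _) (sumTo-0 n))
        }
      ; *-comm = ⋆-comm
      }
    }

  x^suc-⋆-zero : ∀ m f → (x^ suc m ⋆ f) 0 ≈ 0#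
  x^suc-⋆-zero m f = zeroˡ (f 0)

  x^suc-⋆-suc : ∀ m f k → (x^ suc m ⋆ f) (suc k) ≈ (x^ m ⋆ f) k
  x^suc-⋆-suc m f k = trans (sumTo-head k _) (trans (+-congʳ (zeroˡ _)) (+-identityˡ _))

  x^-⋆-shift : ∀ m f k → (x^ m ⋆ f) (m ℕ.+ k) ≈ f k
  x^-⋆-shift zero    f k = x^0-⋆ f k
  x^-⋆-shift (suc m) f k = trans (x^suc-⋆-suc m f (m ℕ.+ k)) (x^-⋆-shift m f k)

  x^-⋆-below : ∀ m f k → k ℕ.< m → (x^ m ⋆ f) k ≈ 0#
  x^-⋆-below (suc m) f zero    _         = x^suc-⋆-zero m f
  x^-⋆-below (suc m) f (suc k) (s≤s k<m) = trans (x^suc-⋆-suc m f k) (x^-⋆-below m f k k<m)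

  x^-+ : ∀ m n k → (x^ (m ℕ.+ n)) k ≈ (x^ m ⋆ x^ n) k
  x^-+ zero    n k       = sym (x^0-⋆ (x^ n) k)
  x^-+ (suc m) n zero    = sym (x^suc-⋆-zero m (x^ n))
  x^-+ (suc m) n (suc k) = trans (x^-+ m n k) (sym (x^suc-⋆-suc m (x^ n) k))

sumTo-pointwise : ∀ {c ℓ} (R : CommutativeSemiring c ℓ) n F k →
  Convolution.sumTo (Convolution.convolution R) n F k ≡ Convolution.sumTo R n (λ m → F m k)
sumTo-pointwise R zero    F k = ≡.refl
sumTo-pointwise R (suc n) F k = ≡.cong (λ s → CommutativeSemiring._+_ R s (F (suc n) k)) (sumTo-pointwise R n F k)

-- Formal power series in q, a, t

-- Imported only now: ℕ's _+_ and _*_ would clash with the semiring operations opened above.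
open import Defs
open import Data.Nat.Base using (_+_; _*_; _<_; _≡ᵇ_)
open import Data.Nat.Properties
  using ( +-*-commutativeSemiring; +-commutativeSemigroup; +-identityʳ; +-suc; +-comm; m≤m+n; m≤n+m; <-≤-trans
        ; m∸n≤m; m+n∸m≡n; ≤⇒≤′; ≤′⇒≤; suc-injective; *-suc; *-monoʳ-≤; ∸-monoʳ-≤; module ≤-Reasoning )
open import Algebra.Properties.CommutativeSemigroup +-commutativeSemigroup using () renaming (x∙yz≈y∙xz to +-leftComm)
open import Data.Nat.ListAction using (sum)
open import Data.Nat.ListAction.Properties using (sum-++)
open import Data.Bool.Base using (Bool; true; false; not; if_then_else_)
open import Data.List.Relation.Unary.Any using (Any; here; there)
open import Data.List.Base using (List; []; _∷_; [_]; _++_; map; concatMap; length; replicate; upTo)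
open import Data.List.Properties using (map-upTo; upTo-∷ʳ; map-++; length-replicate)
open import Data.List.Relation.Unary.All as All using (All; []; _∷_)
open import Data.List.Relation.Unary.All.Properties using (concat⁺; map⁺; applyUpTo⁺₂)
open import Data.Vec.Base using (Vec; toList)
open import Function.Base using (_∘_; id)

ℕ-semiring ℕ⟦t⟧ ℕ⟦a,t⟧ ℕ⟦q,a,t⟧ : CommutativeSemiring 0ℓ 0ℓ
ℕ-semiring = +-*-commutativeSemiring
ℕ⟦t⟧       = Convolution.convolution ℕ-semiring
ℕ⟦a,t⟧     = Convolution.convolution ℕ⟦t⟧
ℕ⟦q,a,t⟧   = Convolution.convolution ℕ⟦a,t⟧

infix 4 _≈_
_≈_ : Series → Series → Set
S ≈ T = ∀ k i j → S k i j ≡ T k i j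

Σ≤-cong : ∀ n {f g : ℕ → ℕ} → (∀ m → f m ≡ g m) → Σ≤ n f ≡ Σ≤ n g
Σ≤-cong zero    f≡g = f≡g 0
Σ≤-cong (suc n) f≡g = ≡.cong₂ _+_ (Σ≤-cong n f≡g) (f≡g (suc n))

sumTo≡Σ≤ : ∀ n f → Convolution.sumTo ℕ-semiring n f ≡ Σ≤ n f
sumTo≡Σ≤ zero    f = ≡.refl
sumTo≡Σ≤ (suc n) f = ≡.cong (_+ f (suc n)) (sumTo≡Σ≤ n f)

open Convolution ℕ⟦a,t⟧ using (_⋆_; x^_; x^-⋆-shift; x^-⋆-below; x^-+)

⊗≈⋆ : ∀ S T → S ⊗ T ≈ S ⋆ T
⊗≈⋆ S T k i j = ≡.sym
  (≡.trans (≡.cong-app (sumTo-pointwise ℕ⟦t⟧ k _ i) j) (≡.trans (sumTo-pointwise ℕ-semiring k _ j)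
  (≡.trans (sumTo≡Σ≤ k _) (Σ≤-cong k λ k′ → ≡.trans (sumTo-pointwise ℕ-semiring i _ j)
  (≡.trans (sumTo≡Σ≤ i _) (Σ≤-cong i λ i′ → sumTo≡Σ≤ j _))))))

qS≈x^ : ∀ m → qS m ≈ x^ m
qS≈x^ zero    zero    zero    zero    = ≡.refl
qS≈x^ zero    zero    zero    (suc j) = ≡.refl
qS≈x^ zero    zero    (suc i) j       = ≡.refl
qS≈x^ zero    (suc k) i       j       = ≡.refl
qS≈x^ (suc m) zero    i       j       = ≡.refl
qS≈x^ (suc m) (suc k) i       j       = qS≈x^ m k i j

series : CommutativeSemiring 0ℓ 0ℓ
series = record
  { Carrier = Series
  ; _≈_ = _≈_
  ; _+_ = _⊕_
  ; _*_ = _⊗_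
  ; 0# = 0S
  ; 1# = 1S
  ; isCommutativeSemiring = isCommutativeSemiring-replace ℕ⟦q,a,t⟧ _⊗_ 1S ⊗≈⋆ (qS≈x^ 0)
  }

open CommutativeSemiring series using (setoid)
  renaming ( refl to ≈-refl; sym to ≈-sym; trans to ≈-trans; reflexive to ≈-reflexive
           ; +-cong to ⊕-cong; +-congˡ to ⊕-congˡ; +-assoc to ⊕-assoc
           ; +-comm to ⊕-comm; +-identityʳ to ⊕-identityʳ
           ; *-cong to ⊗-cong; *-congˡ to ⊗-congˡ; *-congʳ to ⊗-congʳ; *-assoc to ⊗-assoc
           ; *-comm to ⊗-comm; *-identityˡ to ⊗-identityˡ; *-identityʳ to ⊗-identityʳ
           ; zeroʳ to ⊗-zeroʳ; distribˡ to ⊗-distribˡ; distribʳ to ⊗-distribʳ )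
open import Algebra.Properties.CommutativeSemigroup (CommutativeSemiring.+-commutativeSemigroup series)
  using () renaming (interchange to ⊕-interchange)
open import Algebra.Properties.CommutativeSemigroup (CommutativeSemiring.*-commutativeSemigroup series)
  using () renaming (interchange to ⊗-interchange; x∙yz≈y∙xz to ⊗-leftComm)
module ≈-Reasoning = Relation.Binary.Reasoning.Setoid setoid

-- Finite sums

module _ {A : Set} where

  ΣL-cong : ∀ (xs : List A) {F G : A → Series} → (∀ x → F x ≈ G x) → ΣL xs F ≈ ΣL xs G
  ΣL-cong []       F≈G = ≈-refl
  ΣL-cong (x ∷ xs) F≈G = ⊕-cong (F≈G x) (ΣL-cong xs F≈G)

  ΣL-cong-All : ∀ {P : A → Set} {xs F G} → All P xs → (∀ x → P x → F x ≈ G x) → ΣL xs F ≈ ΣL xs G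
  ΣL-cong-All []         F≈G = ≈-refl
  ΣL-cong-All (px ∷ pxs) F≈G = ⊕-cong (F≈G _ px) (ΣL-cong-All pxs F≈G)

  ΣL-cong-at : ∀ (xs : List A) {F G : A → Series} k i j →
    (∀ x → F x k i j ≡ G x k i j) → ΣL xs F k i j ≡ ΣL xs G k i j
  ΣL-cong-at []       k i j F≡G = ≡.refl
  ΣL-cong-at (x ∷ xs) k i j F≡G = ≡.cong₂ _+_ (F≡G x) (ΣL-cong-at xs k i j F≡G)

  ΣL-0 : ∀ (xs : List A) → ΣL xs (λ _ → 0S) ≈ 0S
  ΣL-0 []       = ≈-refl
  ΣL-0 (x ∷ xs) = ΣL-0 xs

  ΣL-++ : ∀ (xs ys : List A) (F : A → Series) → ΣL (xs ++ ys) F ≈ ΣL xs F ⊕ ΣL ys F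
  ΣL-++ []       ys F = ≈-refl
  ΣL-++ (x ∷ xs) ys F = ≈-trans (⊕-congˡ {F x} (ΣL-++ xs ys F)) (≈-sym (⊕-assoc (F x) (ΣL xs F) (ΣL ys F)))

  ΣL-⊕ : ∀ (xs : List A) (F G : A → Series) → ΣL xs (λ x → F x ⊕ G x) ≈ ΣL xs F ⊕ ΣL xs G
  ΣL-⊕ []       F G = ≈-refl
  ΣL-⊕ (x ∷ xs) F G =
    ≈-trans (⊕-congˡ {F x ⊕ G x} (ΣL-⊕ xs F G)) (⊕-interchange (F x) (G x) (ΣL xs F) (ΣL xs G))

  ⊗-ΣL : ∀ X (xs : List A) (F : A → Series) → X ⊗ ΣL xs F ≈ ΣL xs (λ x → X ⊗ F x)
  ⊗-ΣL X []       F = ⊗-zeroʳ X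
  ⊗-ΣL X (x ∷ xs) F = ≈-trans (⊗-distribˡ X (F x) (ΣL xs F)) (⊕-congˡ {X ⊗ F x} (⊗-ΣL X xs F))

module _ {A B : Set} where

  ΣL-map : ∀ (g : A → B) xs (F : B → Series) → ΣL (map g xs) F ≡ ΣL xs (F ∘ g)
  ΣL-map g []       F = ≡.refl
  ΣL-map g (x ∷ xs) F = ≡.cong (F (g x) ⊕_) (ΣL-map g xs F)

  ΣL-concatMap : ∀ (g : A → List B) xs (F : B → Series) → ΣL (concatMap g xs) F ≈ ΣL xs (λ x → ΣL (g x) F)
  ΣL-concatMap g []       F = ≈-refl
  ΣL-concatMap g (x ∷ xs) F = ≈-trans (ΣL-++ (g x) _ F) (⊕-congˡ {ΣL (g x) F} (ΣL-concatMap g xs F))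

  ΣL-swap : ∀ (xs : List A) (ys : List B) (F : A → B → Series) →
    ΣL xs (λ x → ΣL ys (F x)) ≈ ΣL ys (λ y → ΣL xs (λ x → F x y))
  ΣL-swap []       ys F = ≈-sym (ΣL-0 ys)
  ΣL-swap (x ∷ xs) ys F = ≈-trans (⊕-congˡ {ΣL ys (F x)} (ΣL-swap xs ys F)) (≈-sym (ΣL-⊕ ys (F x) _))

ΣL-upTo-head : ∀ n F → ΣL (upTo (suc n)) F ≈ F 0 ⊕ ΣL (upTo n) (F ∘ suc)
ΣL-upTo-head n F =
  ⊕-congˡ {F 0} (≈-reflexive (≡.trans (≡.cong (λ xs → ΣL xs F) (≡.sym (map-upTo suc n))) (ΣL-map suc (upTo n) F)))

ΣL-upTo-last : ∀ n F → ΣL (upTo (suc n)) F ≈ ΣL (upTo n) F ⊕ F n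
ΣL-upTo-last n F = begin
  ΣL (upTo (suc n)) F       ≡⟨ ≡.cong (λ xs → ΣL xs F) (upTo-∷ʳ n) ⟨
  ΣL (upTo n ++ [ n ]) F    ≈⟨ ΣL-++ (upTo n) [ n ] F ⟩
  ΣL (upTo n) F ⊕ (F n ⊕ 0S) ≈⟨ ⊕-congˡ {ΣL (upTo n) F} (⊕-identityʳ (F n)) ⟩
  ΣL (upTo n) F ⊕ F n       ∎
  where open ≈-Reasoning

ΠS-++ : ∀ xs ys → ΠS (xs ++ ys) ≈ ΠS xs ⊗ ΠS ys
ΠS-++ []       ys = ≈-sym (⊗-identityˡ _)
ΠS-++ (x ∷ xs) ys = ≈-trans (⊗-congˡ {x} (ΠS-++ xs ys)) (≈-sym (⊗-assoc x (ΠS xs) (ΠS ys)))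

box-∷ : ∀ C n F → ΣL (box C (suc n)) F ≈ ΣL (upTo (suc C)) λ x → ΣL (box C n) (F ∘ (x ∷_))
box-∷ C n F = ≈-trans (ΣL-concatMap (λ x → map (x ∷_) (box C n)) (upTo (suc C)) F)
  (ΣL-cong (upTo (suc C)) λ x → ≈-reflexive (ΣL-map (x ∷_) (box C n) F))

box-∷ʳ : ∀ C n F → ΣL (box C (suc n)) F ≈ ΣL (box C n) λ δ → ΣL (upTo (suc C)) λ y → F (δ ++ [ y ])
box-∷ʳ C zero    F = ≈-trans (box-∷ C zero F)
  (≈-trans (ΣL-cong (upTo (suc C)) λ y → ⊕-identityʳ (F [ y ])) (≈-sym (⊕-identityʳ _)))
box-∷ʳ C (suc n) F = begin
  ΣL (box C (suc (suc n))) F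
    ≈⟨ box-∷ C (suc n) F ⟩
  ΣL (upTo (suc C)) (λ x → ΣL (box C (suc n)) (F ∘ (x ∷_)))
    ≈⟨ ΣL-cong (upTo (suc C)) (λ x → box-∷ʳ C n (F ∘ (x ∷_))) ⟩
  ΣL (upTo (suc C)) (λ x → ΣL (box C n) λ δ → ΣL (upTo (suc C)) λ y → F (x ∷ δ ++ [ y ]))
    ≈⟨ box-∷ C n _ ⟨
  ΣL (box C (suc n)) (λ δ → ΣL (upTo (suc C)) λ y → F (δ ++ [ y ])) ∎
  where open ≈-Reasoning

box-length : ∀ C n → All (λ γ → length γ ≡ n) (box C n)
box-length C zero    = ≡.refl ∷ []
box-length C (suc n) = concat⁺ (map⁺ (applyUpTo⁺₂ id (suc C) λ x → map⁺ (All.map (≡.cong suc) (box-length C n))))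

allWords-length : ∀ m → All (λ w → length w ≡ m) (allWords m)
allWords-length zero    = ≡.refl ∷ []
allWords-length (suc m) = concat⁺ (map⁺ (All.map (λ p → ≡.cong suc p ∷ ≡.cong suc p ∷ []) (allWords-length m)))

-- Powers of q

qS-⊗ : ∀ m X → qS m ⊗ X ≈ x^ m ⋆ X
qS-⊗ m X = ≈-trans (⊗-congʳ {X} (qS≈x^ m)) (⊗≈⋆ (x^ m) X)

qS-⊗-shift : ∀ m X k i j → (qS m ⊗ X) (m + k) i j ≡ X k i j
qS-⊗-shift m X k i j = ≡.trans (qS-⊗ m X (m + k) i j) (x^-⋆-shift m X k i j)

qS-⊗-below : ∀ m X k i j → k < m → (qS m ⊗ X) k i j ≡ 0
qS-⊗-below m X k i j k<m = ≡.trans (qS-⊗ m X k i j) (x^-⋆-below m X k k<m i j)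

qS-+ : ∀ m n → qS (m + n) ≈ qS m ⊗ qS n
qS-+ m n = ≈-trans (qS≈x^ (m + n)) (≈-trans (x^-+ m n)
  (≈-sym (≈-trans (⊗-cong (qS≈x^ m) (qS≈x^ n)) (⊗≈⋆ (x^ m) (x^ n)))))

geom-unfold : geom ≈ 1S ⊕ qS 1 ⊗ geom
geom-unfold zero    i j = ≡.trans (constant i j) (≡.cong (1S 0 i j +_) (≡.sym (qS-⊗-below 1 geom 0 i j (s≤s z≤n))))
  where
  constant : ∀ i j → geom 0 i j ≡ 1S 0 i j + 0
  constant zero    zero    = ≡.refl
  constant zero    (suc j) = ≡.refl
  constant (suc i) j       = ≡.refl
geom-unfold (suc k) i j = ≡.sym (qS-⊗-shift 1 geom k i j)

geom-⊗-unfold : ∀ Y → geom ⊗ Y ≈ Y ⊕ qS 1 ⊗ (geom ⊗ Y)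
geom-⊗-unfold Y = ≈-trans (⊗-congʳ {Y} geom-unfold)
  (≈-trans (⊗-distribʳ Y 1S (qS 1 ⊗ geom)) (⊕-cong (⊗-identityˡ Y) (⊗-assoc (qS 1) geom Y)))

unfold-unique : ∀ {X Z} Y → X ≈ Y ⊕ qS 1 ⊗ X → Z ≈ Y ⊕ qS 1 ⊗ Z → X ≈ Z
unfold-unique {X} {Z} Y X≈ Z≈ zero i j = begin
  X 0 i j                       ≡⟨ X≈ 0 i j ⟩
  Y 0 i j + (qS 1 ⊗ X) 0 i j    ≡⟨ ≡.cong (Y 0 i j +_) (≡.trans (qS-⊗-below 1 X 0 i j (s≤s z≤n))
                                                                (≡.sym (qS-⊗-below 1 Z 0 i j (s≤s z≤n)))) ⟩
  Y 0 i j + (qS 1 ⊗ Z) 0 i j    ≡⟨ Z≈ 0 i j ⟨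
  Z 0 i j                       ∎
  where open ≡-Reasoning
unfold-unique {X} {Z} Y X≈ Z≈ (suc k) i j = begin
  X (suc k) i j                             ≡⟨ X≈ (suc k) i j ⟩
  Y (suc k) i j + (qS 1 ⊗ X) (suc k) i j    ≡⟨ ≡.cong (Y (suc k) i j +_) (qS-⊗-shift 1 X k i j) ⟩
  Y (suc k) i j + X k i j                   ≡⟨ ≡.cong (Y (suc k) i j +_) (unfold-unique Y X≈ Z≈ k i j) ⟩
  Y (suc k) i j + Z k i j                   ≡⟨ ≡.cong (Y (suc k) i j +_) (qS-⊗-shift 1 Z k i j) ⟨
  Y (suc k) i j + (qS 1 ⊗ Z) (suc k) i j    ≡⟨ Z≈ (suc k) i j ⟨
  Z (suc k) i j                             ∎
  where open ≡-Reasoning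

geom-⊗-unique : ∀ {X} Y → X ≈ Y ⊕ qS 1 ⊗ X → X ≈ geom ⊗ Y
geom-⊗-unique Y X≈ = unfold-unique Y X≈ (geom-⊗-unfold Y)

-- Truncation to boxes

nonzeros : List ℕ → ℕ
nonzeros = count (λ g → not (g ≡ᵇ 0))

nonzeros≤sum : ∀ γ → nonzeros γ ≤ sum γ
nonzeros≤sum []          = z≤n
nonzeros≤sum (zero  ∷ γ) = nonzeros≤sum γ
nonzeros≤sum (suc g ∷ γ) = s≤s (≤-trans (nonzeros≤sum γ) (m≤n+m (sum γ) g))

area≡sum-pred : ∀ γ → area γ ≡ sum (map pred γ)
area≡sum-pred []          = ≡.refl
area≡sum-pred (zero  ∷ γ) = area≡sum-pred γ
area≡sum-pred (suc g ∷ γ) = ≡.trans (+-∸-assoc g (nonzeros≤sum γ)) (≡.cong (g +_) (area≡sum-pred γ))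

area-∷ : ∀ g γ → area (g ∷ γ) ≡ pred g + area γ
area-∷ g γ = ≡.trans (area≡sum-pred (g ∷ γ)) (≡.cong (pred g +_) (≡.sym (area≡sum-pred γ)))

area-> : ∀ {k} γ → Any (suc k <_) γ → k < area γ
area-> {k} γ k+1<γ = ≡.subst (k <_) (≡.sym (area≡sum-pred γ)) (go γ k+1<γ)
  where
  go : ∀ γ → Any (suc k <_) γ → k < sum (map pred γ)
  go (suc g ∷ γ) (here (s≤s k<g)) = <-≤-trans k<g (m≤m+n g _)
  go (g ∷ γ)     (there k+1<γ)    = <-≤-trans (go γ k+1<γ) (m≤n+m _ (pred g))

dinvProduct : List ℕ → List ℕ → Series
dinvProduct pre γ = ΠS (map (λ d → aS ⊕ tS d) (dinvs pre γ))

term-vanishes : ∀ {k} γ i j → Any (suc k <_) γ → term γ k i j ≡ 0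
term-vanishes {k} γ i j k+1<γ = qS-⊗-below (area γ) (dinvProduct [] γ) k i j (area-> γ k+1<γ)

restrict : List Bool → (List ℕ → Series) → List ℕ → Series
restrict v F γ = if compat v γ then F γ else 0S

rhs≤ : ℕ → List Bool → Series
rhs≤ C v = ΣL (box C (length v)) (restrict v term)

infix 4 _≈[≤_]_
_≈[≤_]_ : Series → ℕ → Series → Set
S ≈[≤ k ] T = ∀ k′ → k′ ≤ k → ∀ i j → S k′ i j ≡ T k′ i j

⊗-congˡ-≤ : ∀ X {S T k} → S ≈[≤ k ] T → ∀ i j → (X ⊗ S) k i j ≡ (X ⊗ T) k i j
⊗-congˡ-≤ X {k = k} S≈T i j = Σ≤-cong k λ k′ → Σ≤-cong i λ i′ → Σ≤-cong j λ j′ →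
  ≡.cong (X k′ i′ j′ *_) (S≈T (k ∸ k′) (m∸n≤m k k′) (i ∸ i′) (j ∸ j′))

module _ (k i j : ℕ) where

  box-stable : ∀ n (F : List ℕ → Series) → (∀ γ → Any (suc k <_) γ → F γ k i j ≡ 0) →
    ∀ C → suc k ≤ C → ΣL (box (suc C) n) F k i j ≡ ΣL (box C n) F k i j
  box-stable zero    F F-vanishes C k<C = ≡.refl
  box-stable (suc n) F F-vanishes C k<C = begin
    ΣL (box (suc C) (suc n)) F k i j
      ≡⟨ box-∷ (suc C) n F k i j ⟩
    ΣL (upTo (suc (suc C))) (λ x → ΣL (box (suc C) n) (F ∘ (x ∷_))) k i j
      ≡⟨ ΣL-upTo-last (suc C) (λ x → ΣL (box (suc C) n) (F ∘ (x ∷_))) k i j ⟩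
    ΣL (upTo (suc C)) (λ x → ΣL (box (suc C) n) (F ∘ (x ∷_))) k i j + ΣL (box (suc C) n) (F ∘ (suc C ∷_)) k i j
      ≡⟨ ≡.cong₂ _+_ (ΣL-cong-at (upTo (suc C)) k i j λ x → box-stable′ x) top-vanishes ⟩
    ΣL (upTo (suc C)) (λ x → ΣL (box C n) (F ∘ (x ∷_))) k i j + 0
      ≡⟨ +-identityʳ _ ⟩
    ΣL (upTo (suc C)) (λ x → ΣL (box C n) (F ∘ (x ∷_))) k i j
      ≡⟨ box-∷ C n F k i j ⟨
    ΣL (box C (suc n)) F k i j ∎
    where
    open ≡-Reasoning
    box-stable′ : ∀ x → ΣL (box (suc C) n) (F ∘ (x ∷_)) k i j ≡ ΣL (box C n) (F ∘ (x ∷_)) k i j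
    box-stable′ x = box-stable n (F ∘ (x ∷_)) (λ δ k+1<δ → F-vanishes (x ∷ δ) (there k+1<δ)) C k<C
    top-vanishes : ΣL (box (suc C) n) (F ∘ (suc C ∷_)) k i j ≡ 0
    top-vanishes = ≡.trans
      (ΣL-cong-at (box (suc C) n) k i j λ δ → F-vanishes (suc C ∷ δ) (here (s≤s k<C)))
      (ΣL-0 (box (suc C) n) k i j)

  box-truncate : ∀ n F → (∀ γ → Any (suc k <_) γ → F γ k i j ≡ 0) →
    ∀ {C} → suc k ≤ C → ΣL (box C n) F k i j ≡ ΣL (box (suc k) n) F k i j
  box-truncate n F F-vanishes k<C = go (≤⇒≤′ k<C)
    where
    go : ∀ {C} → suc k ≤′ C → ΣL (box C n) F k i j ≡ ΣL (box (suc k) n) F k i j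
    go ≤′-refl          = ≡.refl
    go (≤′-step k<′C) = ≡.trans (box-stable n F F-vanishes _ (≤′⇒≤ k<′C)) (go k<′C)

rhs≤-truncate : ∀ v {C k} → suc k ≤ C → rhs≤ C v ≈[≤ k ] rhsCoeff v
rhs≤-truncate v {C} k<C k′ k′≤k i j =
  box-truncate k′ i j (length v) _ compatible-vanishes (≤-trans (s≤s k′≤k) k<C)
  where
  compatible-vanishes : ∀ γ → Any (suc k′ <_) γ → restrict v term γ k′ i j ≡ 0
  compatible-vanishes γ k′+1<γ with compat v γ
  ... | true  = term-vanishes γ i j k′+1<γ
  ... | false = ≡.refl

-- The recurrence

zeros : List Bool → ℕ
zeros = count not

lift : List Bool → List ℕ → List ℕ
lift []          _        = []
lift (true  ∷ v) γ′       = 0 ∷ lift v γ′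
lift (false ∷ v) []       = []
lift (false ∷ v) (g ∷ γ′) = suc g ∷ lift v γ′

zeroPattern : List ℕ → List Bool
zeroPattern = map (_≡ᵇ 0)

ΣL-compatible : ∀ B v (F : List ℕ → Series) →
  ΣL (box (suc B) (length v)) (restrict v F) ≈ ΣL (box B (zeros v)) (F ∘ lift v)
ΣL-compatible B []          F = ≈-refl
ΣL-compatible B (true  ∷ v) F = begin
  ΣL (box (suc B) (suc (length v))) (restrict (true ∷ v) F)
    ≈⟨ box-∷ (suc B) (length v) _ ⟩
  ΣL (upTo (suc (suc B))) slice
    ≈⟨ ΣL-upTo-head (suc B) slice ⟩
  ΣL (box (suc B) (length v)) (restrict v (F ∘ (0 ∷_))) ⊕ ΣL (upTo (suc B)) (λ _ → ΣL (box (suc B) (length v)) λ _ → 0S)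
    ≈⟨ ⊕-cong (ΣL-compatible B v (F ∘ (0 ∷_)))
              (≈-trans (ΣL-cong (upTo (suc B)) λ _ → ΣL-0 (box (suc B) (length v))) (ΣL-0 (upTo (suc B)))) ⟩
  ΣL (box B (zeros v)) (λ γ′ → F (0 ∷ lift v γ′)) ⊕ 0S
    ≈⟨ ⊕-identityʳ _ ⟩
  ΣL (box B (zeros v)) (λ γ′ → F (0 ∷ lift v γ′)) ∎
  where
  open ≈-Reasoning
  slice : ℕ → Series
  slice x = ΣL (box (suc B) (length v)) λ δ → restrict (true ∷ v) F (x ∷ δ)
ΣL-compatible B (false ∷ v) F = begin
  ΣL (box (suc B) (suc (length v))) (restrict (false ∷ v) F)
    ≈⟨ box-∷ (suc B) (length v) _ ⟩
  ΣL (upTo (suc (suc B))) slice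
    ≈⟨ ΣL-upTo-head (suc B) slice ⟩
  ΣL (box (suc B) (length v)) (λ _ → 0S) ⊕ ΣL (upTo (suc B)) (λ x → ΣL (box (suc B) (length v)) (restrict v (F ∘ (suc x ∷_))))
    ≈⟨ ⊕-cong (ΣL-0 (box (suc B) (length v))) (ΣL-cong (upTo (suc B)) λ x → ΣL-compatible B v (F ∘ (suc x ∷_))) ⟩
  ΣL (upTo (suc B)) (λ x → ΣL (box B (zeros v)) λ γ′ → F (suc x ∷ lift v γ′))
    ≈⟨ box-∷ B (zeros v) (F ∘ lift (false ∷ v)) ⟨
  ΣL (box B (suc (zeros v))) (F ∘ lift (false ∷ v)) ∎
  where
  open ≈-Reasoning
  slice : ℕ → Series
  slice x = ΣL (box (suc B) (length v)) λ δ → restrict (false ∷ v) F (x ∷ δ)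

ΣL-compat-zeroPattern : ∀ m γ → length γ ≡ m → (H : List Bool → Series) →
  ΣL (allWords m) (λ w → if compat w γ then H w else 0S) ≈ H (zeroPattern γ)
ΣL-compat-zeroPattern zero    []          _   H = ⊕-identityʳ (H [])
ΣL-compat-zeroPattern (suc m) (zero  ∷ γ) |γ| H =
  ≈-trans (ΣL-concatMap (λ w → (false ∷ w) ∷ (true ∷ w) ∷ []) (allWords m) _)
  (≈-trans (ΣL-cong (allWords m) λ w → ⊕-identityʳ (if compat w γ then H (true ∷ w) else 0S))
  (ΣL-compat-zeroPattern m γ (suc-injective |γ|) (H ∘ (true ∷_))))
ΣL-compat-zeroPattern (suc m) (suc g ∷ γ) |γ| H =
  ≈-trans (ΣL-concatMap (λ w → (false ∷ w) ∷ (true ∷ w) ∷ []) (allWords m) _)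
  (≈-trans (ΣL-cong (allWords m) λ w → ⊕-identityʳ (if compat w γ then H (false ∷ w) else 0S))
  (ΣL-compat-zeroPattern m γ (suc-injective |γ|) (H ∘ (false ∷_))))

ΣL-by-zeroPattern : ∀ B m (F : List Bool → List ℕ → Series) →
  ΣL (box B m) (λ γ → F (zeroPattern γ) γ) ≈ ΣL (allWords m) (λ w → ΣL (box B m) (restrict w (F w)))
ΣL-by-zeroPattern B m F =
  ≈-trans (ΣL-cong-All (box-length B m) (λ γ |γ| → ≈-sym (ΣL-compat-zeroPattern m γ |γ| (λ w → F w γ))))
  (ΣL-swap (box B m) (allWords m) _)

length≡ones+zeros : ∀ v → length v ≡ ones v + zeros v
length≡ones+zeros []          = ≡.refl
length≡ones+zeros (true  ∷ v) = ≡.cong suc (length≡ones+zeros v)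
length≡ones+zeros (false ∷ v) = ≡.trans (≡.cong suc (length≡ones+zeros v)) (≡.sym (+-suc _ _))

length≡ones-zeroPattern+nonzeros : ∀ γ → length γ ≡ ones (zeroPattern γ) + nonzeros γ
length≡ones-zeroPattern+nonzeros []          = ≡.refl
length≡ones-zeroPattern+nonzeros (zero  ∷ γ) = ≡.cong suc (length≡ones-zeroPattern+nonzeros γ)
length≡ones-zeroPattern+nonzeros (suc g ∷ γ) =
  ≡.trans (≡.cong suc (length≡ones-zeroPattern+nonzeros γ)) (≡.sym (+-suc _ _))

sum≡nonzeros+sum-pred : ∀ γ → sum γ ≡ nonzeros γ + sum (map pred γ)
sum≡nonzeros+sum-pred []          = ≡.refl
sum≡nonzeros+sum-pred (zero  ∷ γ) = sum≡nonzeros+sum-pred γ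
sum≡nonzeros+sum-pred (suc g ∷ γ) =
  ≡.cong suc (≡.trans (≡.cong (g +_) (sum≡nonzeros+sum-pred γ)) (+-leftComm g (nonzeros γ) (sum (map pred γ))))

sum-pred-lift : ∀ v γ′ → length γ′ ≡ zeros v → sum (map pred (lift v γ′)) ≡ sum γ′
sum-pred-lift []          []       _    = ≡.refl
sum-pred-lift (true  ∷ v) γ′       |γ′| = sum-pred-lift v γ′ |γ′|
sum-pred-lift (false ∷ v) (g ∷ γ′) |γ′| = ≡.cong (g +_) (sum-pred-lift v γ′ (suc-injective |γ′|))

area-lift : ∀ v γ′ → length γ′ ≡ zeros v →
  area (lift v γ′) ≡ (length v ∸ ones v ∸ ones (zeroPattern γ′)) + area γ′
area-lift v γ′ |γ′| = begin
  area (lift v γ′)                              ≡⟨ area≡sum-pred (lift v γ′) ⟩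
  sum (map pred (lift v γ′))                    ≡⟨ sum-pred-lift v γ′ |γ′| ⟩
  sum γ′                                        ≡⟨ sum≡nonzeros+sum-pred γ′ ⟩
  nonzeros γ′ + sum (map pred γ′)               ≡⟨ ≡.cong₂ _+_ nonzeros≡ (area≡sum-pred γ′) ⟨
  (length v ∸ ones v ∸ ones (zeroPattern γ′)) + area γ′ ∎
  where
  open ≡-Reasoning
  o = ones (zeroPattern γ′)
  nonzeros≡ : length v ∸ ones v ∸ o ≡ nonzeros γ′
  nonzeros≡ = begin
    length v ∸ ones v ∸ o          ≡⟨ ≡.cong (λ l → l ∸ ones v ∸ o) (length≡ones+zeros v) ⟩
    ones v + zeros v ∸ ones v ∸ o  ≡⟨ ≡.cong (_∸ o) (m+n∸m≡n (ones v) (zeros v)) ⟩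
    zeros v ∸ o                    ≡⟨ ≡.cong (_∸ o) (≡.trans (≡.sym |γ′|) (length≡ones-zeroPattern+nonzeros γ′)) ⟩
    o + nonzeros γ′ ∸ o            ≡⟨ m+n∸m≡n o (nonzeros γ′) ⟩
    nonzeros γ′                    ∎

count-lift-one : ∀ v γ′ → length γ′ ≡ zeros v →
  count (_≡ᵇ 1) (lift v γ′) ≡ count (_≡ᵇ 2) (merge v (zeroPattern γ′))
count-lift-one []          γ′          _    = ≡.refl
count-lift-one (true  ∷ v) γ′          |γ′| = count-lift-one v γ′ |γ′|
count-lift-one (false ∷ v) (zero  ∷ γ′) |γ′| = ≡.cong suc (count-lift-one v γ′ (suc-injective |γ′|))
count-lift-one (false ∷ v) (suc g ∷ γ′) |γ′| = count-lift-one v γ′ (suc-injective |γ′|)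

count-lift-suc : ∀ v γ′ y → length γ′ ≡ zeros v → count (_≡ᵇ suc y) (lift v γ′) ≡ count (_≡ᵇ y) γ′
count-lift-suc []          []       y _    = ≡.refl
count-lift-suc (true  ∷ v) γ′       y |γ′| = count-lift-suc v γ′ y |γ′|
count-lift-suc (false ∷ v) (g ∷ γ′) y |γ′| with g ≡ᵇ y
... | true  = ≡.cong suc (count-lift-suc v γ′ y (suc-injective |γ′|))
... | false = count-lift-suc v γ′ y (suc-injective |γ′|)

Pfactors-merge-false : ∀ c v g γ′ →
  Pfactors c (merge (false ∷ v) (zeroPattern (g ∷ γ′))) ≡ Pfactors c (merge v (zeroPattern γ′))
Pfactors-merge-false c v zero    γ′ = ≡.refl
Pfactors-merge-false c v (suc g) γ′ = ≡.refl

-- L is the reversed prefix of lift v γ′ already read and pre the corresponding prefix of γ′; the 0's of L are the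
-- 1's of u read so far, and an entry suc g of L is an entry g of pre.
dinvProduct-lift : ∀ v γ′ L pre c → length γ′ ≡ zeros v →
  count (_≡ᵇ 0) L ≡ c → (∀ g → count (_≡ᵇ suc g) L ≡ count (_≡ᵇ g) pre) →
  dinvProduct L (lift v γ′) ≈ ΠS (Pfactors c (merge v (zeroPattern γ′))) ⊗ dinvProduct pre γ′
dinvProduct-lift []          []       L pre c _    _     _     = ≈-sym (⊗-identityˡ 1S)
dinvProduct-lift (true  ∷ v) γ′       L pre c |γ′| #0L≡c #L≡#pre = begin
  (aS ⊕ tS d) ⊗ dinvProduct (0 ∷ L) (lift v γ′)
    ≈⟨ ⊗-cong (⊕-comm aS (tS d)) (dinvProduct-lift v γ′ (0 ∷ L) pre (suc c) |γ′| (≡.cong suc #0L≡c) #L≡#pre) ⟩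
  (tS d ⊕ aS) ⊗ (ΠS (Pfactors (suc c) (merge v (zeroPattern γ′))) ⊗ dinvProduct pre γ′)
    ≈⟨ ⊗-assoc (tS d ⊕ aS) (ΠS (Pfactors (suc c) (merge v (zeroPattern γ′)))) (dinvProduct pre γ′) ⟨
  ((tS d ⊕ aS) ⊗ ΠS (Pfactors (suc c) (merge v (zeroPattern γ′)))) ⊗ dinvProduct pre γ′
    ≡⟨ ≡.cong (λ e → ((tS e ⊕ aS) ⊗ ΠS (Pfactors (suc c) (merge v (zeroPattern γ′)))) ⊗ dinvProduct pre γ′)
         (≡.cong₂ _+_ #0L≡c (count-lift-one v γ′ |γ′|)) ⟩
  ΠS (Pfactors c (merge (true ∷ v) (zeroPattern γ′))) ⊗ dinvProduct pre γ′ ∎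
  where
  open ≈-Reasoning
  d = count (_≡ᵇ 0) L + count (_≡ᵇ 1) (lift v γ′)
dinvProduct-lift (false ∷ v) (g ∷ γ′) L pre c |γ′| #0L≡c #L≡#pre = begin
  (aS ⊕ tS (count (_≡ᵇ suc g) L + count (_≡ᵇ suc (suc g)) (lift v γ′))) ⊗ dinvProduct (suc g ∷ L) (lift v γ′)
    ≈⟨ ⊗-cong (≈-reflexive (≡.cong (λ e → aS ⊕ tS e) (≡.cong₂ _+_ (#L≡#pre g) (count-lift-suc v γ′ (suc g) |γ′|′))))
              (dinvProduct-lift v γ′ (suc g ∷ L) (g ∷ pre) c |γ′|′ #0L≡c #L≡#pre′) ⟩
  (aS ⊕ tS d) ⊗ (ΠS (Pfactors c (merge v (zeroPattern γ′))) ⊗ dinvProduct (g ∷ pre) γ′)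
    ≈⟨ ⊗-leftComm (aS ⊕ tS d) (ΠS (Pfactors c (merge v (zeroPattern γ′)))) (dinvProduct (g ∷ pre) γ′) ⟩
  ΠS (Pfactors c (merge v (zeroPattern γ′))) ⊗ dinvProduct pre (g ∷ γ′)
    ≡⟨ ≡.cong (λ fs → ΠS fs ⊗ dinvProduct pre (g ∷ γ′)) (Pfactors-merge-false c v g γ′) ⟨
  ΠS (Pfactors c (merge (false ∷ v) (zeroPattern (g ∷ γ′)))) ⊗ dinvProduct pre (g ∷ γ′) ∎
  where
  open ≈-Reasoning
  d = count (_≡ᵇ g) pre + count (_≡ᵇ suc g) γ′
  |γ′|′ = suc-injective |γ′|
  #L≡#pre′ : ∀ g′ → count (_≡ᵇ suc g′) (suc g ∷ L) ≡ count (_≡ᵇ g′) (g ∷ pre)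
  #L≡#pre′ g′ with g ≡ᵇ g′
  ... | true  = ≡.cong suc (#L≡#pre g′)
  ... | false = #L≡#pre g′

term-lift : ∀ v γ′ → length γ′ ≡ zeros v →
  term (lift v γ′) ≈ qS (length v ∸ ones v ∸ ones (zeroPattern γ′)) ⊗ P v (zeroPattern γ′) ⊗ term γ′
term-lift v γ′ |γ′| = begin
  qS (area (lift v γ′)) ⊗ dinvProduct [] (lift v γ′)
    ≈⟨ ⊗-cong (≈-trans (≈-reflexive (≡.cong qS (area-lift v γ′ |γ′|))) (qS-+ e (area γ′)))
              (dinvProduct-lift v γ′ [] [] 0 |γ′| ≡.refl (λ _ → ≡.refl)) ⟩
  (qS e ⊗ qS (area γ′)) ⊗ (P v (zeroPattern γ′) ⊗ dinvProduct [] γ′)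
    ≈⟨ ⊗-interchange (qS e) (qS (area γ′)) (P v (zeroPattern γ′)) (dinvProduct [] γ′) ⟩
  qS e ⊗ P v (zeroPattern γ′) ⊗ term γ′ ∎
  where
  open ≈-Reasoning
  e = length v ∸ ones v ∸ ones (zeroPattern γ′)

recurrence : List Bool → (List Bool → Series) → Series
recurrence v F = ΣL (allWords (length v ∸ ones v)) λ w → qS (length v ∸ ones v ∸ ones w) ⊗ P v w ⊗ F w

⊗-if : ∀ X b T → X ⊗ (if b then T else 0S) ≈ (if b then X ⊗ T else 0S)
⊗-if X true  T = ≈-refl
⊗-if X false T = ⊗-zeroʳ X

rhs≤-step : ∀ B v → rhs≤ (suc B) v ≈ recurrence v (rhs≤ B)
rhs≤-step B v = begin
  rhs≤ (suc B) v
    ≈⟨ ΣL-compatible B v term ⟩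
  ΣL (box B (zeros v)) (term ∘ lift v)
    ≈⟨ ΣL-cong-All (box-length B (zeros v)) (λ γ′ |γ′| → term-lift v γ′ |γ′|) ⟩
  ΣL (box B (zeros v)) (λ γ′ → X (zeroPattern γ′) ⊗ term γ′)
    ≡⟨ ≡.cong (λ l → ΣL (box B l) λ γ′ → X (zeroPattern γ′) ⊗ term γ′) zeros≡m ⟩
  ΣL (box B m) (λ γ′ → X (zeroPattern γ′) ⊗ term γ′)
    ≈⟨ ΣL-by-zeroPattern B m (λ w γ′ → X w ⊗ term γ′) ⟩
  ΣL (allWords m) (λ w → ΣL (box B m) (restrict w (λ γ′ → X w ⊗ term γ′)))
    ≈⟨ ΣL-cong-All (allWords-length m) slice ⟨
  recurrence v (rhs≤ B) ∎
  where
  open ≈-Reasoning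
  m = length v ∸ ones v
  X : List Bool → Series
  X w = qS (m ∸ ones w) ⊗ P v w
  zeros≡m : zeros v ≡ m
  zeros≡m = ≡.sym (≡.trans (≡.cong (_∸ ones v) (length≡ones+zeros v)) (m+n∸m≡n (ones v) (zeros v)))
  slice : ∀ w → length w ≡ m → X w ⊗ rhs≤ B w ≈ ΣL (box B m) (restrict w (λ γ′ → X w ⊗ term γ′))
  slice w |w| = ≈-trans (⊗-ΣL (X w) (box B (length w)) _)
    (≈-trans (ΣL-cong (box B (length w)) λ γ′ → ⊗-if (X w) (compat w γ′) (term γ′))
    (≈-reflexive (≡.cong (λ l → ΣL (box B l) (restrict w (λ γ′ → X w ⊗ term γ′))) |w|)))

rhsCoeff-step : ∀ v → rhsCoeff v ≈ recurrence v rhsCoeff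
rhsCoeff-step v k i j = begin
  rhsCoeff v k i j                   ≡⟨ rhs≤-truncate v (n≤1+n (suc k)) k ≤-refl i j ⟨
  rhs≤ (suc (suc k)) v k i j         ≡⟨ rhs≤-step (suc k) v k i j ⟩
  recurrence v (rhs≤ (suc k)) k i j  ≡⟨ ΣL-cong-at (allWords m) k i j truncate-slice ⟩
  recurrence v rhsCoeff k i j        ∎
  where
  open ≡-Reasoning
  m = length v ∸ ones v
  truncate-slice : ∀ w → (qS (m ∸ ones w) ⊗ P v w ⊗ rhs≤ (suc k) w) k i j ≡ (qS (m ∸ ones w) ⊗ P v w ⊗ rhsCoeff w) k i j
  truncate-slice w = ⊗-congˡ-≤ (qS (m ∸ ones w) ⊗ P v w) (rhs≤-truncate w {suc k} {k} ≤-refl) i j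

-- The all-zero words

count-++ : ∀ {A : Set} (p : A → Bool) xs ys → count p (xs ++ ys) ≡ count p xs + count p ys
count-++ p []       ys = ≡.refl
count-++ p (x ∷ xs) ys with p x
... | true  = ≡.cong suc (count-++ p xs ys)
... | false = count-++ p xs ys

dinvs-cong : ∀ pre pre′ δ → (∀ y → count (_≡ᵇ y) pre ≡ count (_≡ᵇ y) pre′) → dinvs pre δ ≡ dinvs pre′ δ
dinvs-cong pre pre′ []      #pre≡#pre′ = ≡.refl
dinvs-cong pre pre′ (g ∷ δ) #pre≡#pre′ =
  ≡.cong₂ _∷_ (≡.cong (_+ count (_≡ᵇ suc g) δ) (#pre≡#pre′ g)) (dinvs-cong (g ∷ pre) (g ∷ pre′) δ #g∷pre≡#g∷pre′)
  where
  #g∷pre≡#g∷pre′ : ∀ y → count (_≡ᵇ y) (g ∷ pre) ≡ count (_≡ᵇ y) (g ∷ pre′)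
  #g∷pre≡#g∷pre′ y with g ≡ᵇ y
  ... | true  = ≡.cong suc (#pre≡#pre′ y)
  ... | false = #pre≡#pre′ y

count-swap : ∀ a b pre y → count (_≡ᵇ y) (a ∷ b ∷ pre) ≡ count (_≡ᵇ y) (b ∷ a ∷ pre)
count-swap a b pre y with a ≡ᵇ y | b ≡ᵇ y
... | true  | true  = ≡.refl
... | true  | false = ≡.refl
... | false | true  = ≡.refl
... | false | false = ≡.refl

-- A last entry suc x counts, for the earlier entries, exactly as a first entry x would.
dinvs-∷ʳ : ∀ pre δ x →
  dinvs pre (δ ++ [ suc x ]) ≡ dinvs (x ∷ pre) δ ++ [ count (_≡ᵇ suc x) pre + count (_≡ᵇ suc x) δ ]
dinvs-∷ʳ pre []      x = ≡.refl
dinvs-∷ʳ pre (g ∷ δ) x = ≡.cong₂ _∷_ head-dinv (begin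
  dinvs (g ∷ pre) (δ ++ [ suc x ])
    ≡⟨ dinvs-∷ʳ (g ∷ pre) δ x ⟩
  dinvs (x ∷ g ∷ pre) δ ++ [ count (_≡ᵇ suc x) (g ∷ pre) + count (_≡ᵇ suc x) δ ]
    ≡⟨ ≡.cong₂ (λ ds d → ds ++ [ d ]) (dinvs-cong (x ∷ g ∷ pre) (g ∷ x ∷ pre) δ (count-swap x g pre)) last-dinv ⟩
  dinvs (g ∷ x ∷ pre) δ ++ [ count (_≡ᵇ suc x) pre + count (_≡ᵇ suc x) (g ∷ δ) ] ∎)
  where
  open ≡-Reasoning
  head-dinv : count (_≡ᵇ g) pre + count (_≡ᵇ suc g) (δ ++ [ suc x ]) ≡ count (_≡ᵇ g) (x ∷ pre) + count (_≡ᵇ suc g) δ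
  head-dinv rewrite count-++ (_≡ᵇ suc g) δ [ suc x ] with x ≡ᵇ g
  ... | true  = ≡.trans (≡.cong (count (_≡ᵇ g) pre +_) (+-comm _ 1)) (+-suc _ _)
  ... | false = ≡.cong (count (_≡ᵇ g) pre +_) (+-identityʳ _)
  last-dinv : count (_≡ᵇ suc x) (g ∷ pre) + count (_≡ᵇ suc x) δ ≡ count (_≡ᵇ suc x) pre + count (_≡ᵇ suc x) (g ∷ δ)
  last-dinv with g ≡ᵇ suc x
  ... | true  = ≡.sym (+-suc _ _)
  ... | false = ≡.refl

dinvProduct-rotate : ∀ δ x → dinvProduct [] (δ ++ [ suc x ]) ≈ dinvProduct [] (x ∷ δ)
dinvProduct-rotate δ x = begin
  ΠS (map factor (dinvs [] (δ ++ [ suc x ])))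
    ≡⟨ ≡.cong (ΠS ∘ map factor) (dinvs-∷ʳ [] δ x) ⟩
  ΠS (map factor (dinvs [ x ] δ ++ [ d ]))
    ≡⟨ ≡.cong ΠS (map-++ factor (dinvs [ x ] δ) [ d ]) ⟩
  ΠS (map factor (dinvs [ x ] δ) ++ [ factor d ])
    ≈⟨ ΠS-++ (map factor (dinvs [ x ] δ)) [ factor d ] ⟩
  dinvProduct [ x ] δ ⊗ (factor d ⊗ 1S)
    ≈⟨ ⊗-congˡ {dinvProduct [ x ] δ} (⊗-identityʳ (factor d)) ⟩
  dinvProduct [ x ] δ ⊗ factor d
    ≈⟨ ⊗-comm (dinvProduct [ x ] δ) (factor d) ⟩
  factor d ⊗ dinvProduct [ x ] δ ∎
  where
  open ≈-Reasoning
  factor : ℕ → Series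
  factor d = aS ⊕ tS d
  d = count (_≡ᵇ suc x) δ

area-∷ʳ : ∀ δ g → area (δ ++ [ g ]) ≡ area δ + pred g
area-∷ʳ δ g = begin
  area (δ ++ [ g ])                           ≡⟨ area≡sum-pred (δ ++ [ g ]) ⟩
  sum (map pred (δ ++ [ g ]))                 ≡⟨ ≡.cong sum (map-++ pred δ [ g ]) ⟩
  sum (map pred δ ++ [ pred g ])              ≡⟨ sum-++ (map pred δ) [ pred g ] ⟩
  sum (map pred δ) + (pred g + 0)             ≡⟨ ≡.cong₂ _+_ (area≡sum-pred δ) (≡.sym (+-identityʳ (pred g))) ⟨
  area δ + pred g                             ∎
  where open ≡-Reasoning

term-rotate-one : ∀ δ → term (δ ++ [ 1 ]) ≈ term (0 ∷ δ)
term-rotate-one δ = ⊗-cong (≈-reflexive (≡.cong qS (≡.trans (area-∷ʳ δ 1) (+-identityʳ (area δ))))) (dinvProduct-rotate δ 0)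

term-rotate : ∀ δ x → term (δ ++ [ suc (suc x) ]) ≈ qS 1 ⊗ term (suc x ∷ δ)
term-rotate δ x = begin
  qS (area (δ ++ [ suc (suc x) ])) ⊗ dinvProduct [] (δ ++ [ suc (suc x) ])
    ≈⟨ ⊗-cong (≈-reflexive (≡.cong qS area≡)) (dinvProduct-rotate δ (suc x)) ⟩
  qS (1 + area (suc x ∷ δ)) ⊗ dinvProduct [] (suc x ∷ δ)
    ≈⟨ ⊗-congʳ {dinvProduct [] (suc x ∷ δ)} (qS-+ 1 (area (suc x ∷ δ))) ⟩
  (qS 1 ⊗ qS (area (suc x ∷ δ))) ⊗ dinvProduct [] (suc x ∷ δ)
    ≈⟨ ⊗-assoc (qS 1) (qS (area (suc x ∷ δ))) (dinvProduct [] (suc x ∷ δ)) ⟩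
  qS 1 ⊗ term (suc x ∷ δ) ∎
  where
  open ≈-Reasoning
  area≡ : area (δ ++ [ suc (suc x) ]) ≡ 1 + area (suc x ∷ δ)
  area≡ = ≡.trans (area-∷ʳ δ (suc (suc x))) (≡.trans (+-comm (area δ) (suc x)) (≡.cong suc (≡.sym (area-∷ (suc x) δ))))

zeros-replicate : ∀ n → zeros (replicate n false) ≡ n
zeros-replicate zero    = ≡.refl
zeros-replicate (suc n) = ≡.cong suc (zeros-replicate n)

lift-replicate : ∀ n δ → length δ ≡ n → lift (replicate n false) δ ≡ map suc δ
lift-replicate zero    []      _   = ≡.refl
lift-replicate (suc n) (g ∷ δ) |δ| = ≡.cong (suc g ∷_) (lift-replicate n δ (suc-injective |δ|))

ΣL-lift-replicate : ∀ B n (F : List ℕ → Series) →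
  ΣL (box B (zeros (replicate n false))) (F ∘ lift (replicate n false)) ≈ ΣL (box B n) (F ∘ map suc)
ΣL-lift-replicate B n F =
  ≈-trans (≈-reflexive (≡.cong (λ l → ΣL (box B l) (F ∘ lift (replicate n false))) (zeros-replicate n)))
  (ΣL-cong-All (box-length B n) λ δ |δ| → ≈-reflexive (≡.cong F (lift-replicate n δ |δ|)))

module _ (n : ℕ) where

  private
    z = replicate n false

  positive zeroThenPositive firstBelow firstAt : ℕ → Series
  positive         B = ΣL (box B (suc n)) (term ∘ map suc)
  zeroThenPositive B = ΣL (box B n) λ δ → term (0 ∷ map suc δ)
  firstBelow       B = ΣL (upTo B) λ x → ΣL (box B n) λ δ → term (map suc (x ∷ δ))
  firstAt          B = ΣL (box B n) λ δ → term (map suc (B ∷ δ))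

  rhs≤-zeros : ∀ B → rhs≤ (suc B) (false ∷ z) ≈ positive B
  rhs≤-zeros B = ≈-trans (ΣL-compatible B (false ∷ z) term) (ΣL-lift-replicate B (suc n) term)

  rhs≤-one-zeros : ∀ B → rhs≤ (suc B) (true ∷ z) ≈ zeroThenPositive B
  rhs≤-one-zeros B = ≈-trans (ΣL-compatible B (true ∷ z) term) (ΣL-lift-replicate B n (term ∘ (0 ∷_)))

  positive-split-first : ∀ B → positive B ≈ firstBelow B ⊕ firstAt B
  positive-split-first B = ≈-trans (box-∷ B n (term ∘ map suc)) (ΣL-upTo-last B _)

  positive-rotate : ∀ B → positive B ≈ zeroThenPositive B ⊕ qS 1 ⊗ firstBelow B
  positive-rotate B = begin
    positive B
      ≈⟨ box-∷ʳ B n (term ∘ map suc) ⟩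
    ΣL (box B n) (λ δ → ΣL (upTo (suc B)) λ y → term (map suc (δ ++ [ y ])))
      ≈⟨ ΣL-cong (box B n) rotate ⟩
    ΣL (box B n) (λ δ → term (0 ∷ map suc δ) ⊕ qS 1 ⊗ ΣL (upTo B) (first δ))
      ≈⟨ ΣL-⊕ (box B n) _ _ ⟩
    zeroThenPositive B ⊕ ΣL (box B n) (λ δ → qS 1 ⊗ ΣL (upTo B) (first δ))
      ≈⟨ ⊕-congˡ {zeroThenPositive B} (≈-sym (⊗-ΣL (qS 1) (box B n) _)) ⟩
    zeroThenPositive B ⊕ qS 1 ⊗ ΣL (box B n) (λ δ → ΣL (upTo B) (first δ))
      ≈⟨ ⊕-congˡ {zeroThenPositive B} (⊗-congˡ {qS 1} (ΣL-swap (box B n) (upTo B) _)) ⟩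
    zeroThenPositive B ⊕ qS 1 ⊗ firstBelow B ∎
    where
    open ≈-Reasoning
    first : List ℕ → ℕ → Series
    first δ x = term (map suc (x ∷ δ))
    rotate : ∀ δ → ΣL (upTo (suc B)) (λ y → term (map suc (δ ++ [ y ])))
                 ≈ term (0 ∷ map suc δ) ⊕ qS 1 ⊗ ΣL (upTo B) (first δ)
    rotate δ = begin
      ΣL (upTo (suc B)) (λ y → term (map suc (δ ++ [ y ])))
        ≈⟨ ΣL-cong (upTo (suc B)) (λ y → ≈-reflexive (≡.cong term (map-++ suc δ [ y ]))) ⟩
      ΣL (upTo (suc B)) (λ y → term (map suc δ ++ [ suc y ]))
        ≈⟨ ΣL-upTo-head B _ ⟩
      term (map suc δ ++ [ 1 ]) ⊕ ΣL (upTo B) (λ x → term (map suc δ ++ [ suc (suc x) ]))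
        ≈⟨ ⊕-cong (term-rotate-one (map suc δ)) (ΣL-cong (upTo B) λ x → term-rotate (map suc δ) x) ⟩
      term (0 ∷ map suc δ) ⊕ ΣL (upTo B) (λ x → qS 1 ⊗ first δ x)
        ≈⟨ ⊕-congˡ {term (0 ∷ map suc δ)} (≈-sym (⊗-ΣL (qS 1) (upTo B) (first δ))) ⟩
      term (0 ∷ map suc δ) ⊕ qS 1 ⊗ ΣL (upTo B) (first δ) ∎

  rhsCoeff-zeros-unfold : rhsCoeff (false ∷ z) ≈ rhsCoeff (true ∷ z) ⊕ qS 1 ⊗ rhsCoeff (false ∷ z)
  rhsCoeff-zeros-unfold k i j = begin
    rhsCoeff (false ∷ z) k i j
      ≡⟨ rhs≤-truncate (false ∷ z) k<B+1 k ≤-refl i j ⟨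
    rhs≤ (suc B) (false ∷ z) k i j
      ≡⟨ ≈-trans (rhs≤-zeros B) (positive-rotate B) k i j ⟩
    zeroThenPositive B k i j + (qS 1 ⊗ firstBelow B) k i j
      ≡⟨ ≡.cong₂ _+_ (≡.trans (≡.sym (rhs≤-one-zeros B k i j)) (rhs≤-truncate (true ∷ z) k<B+1 k ≤-refl i j))
                     (⊗-congˡ-≤ (qS 1) firstBelow≈ i j) ⟩
    rhsCoeff (true ∷ z) k i j + (qS 1 ⊗ rhsCoeff (false ∷ z)) k i j ∎
    where
    open ≡-Reasoning
    B = suc k
    k<B+1 : suc k ≤ suc B
    k<B+1 = n≤1+n (suc k)
    firstBelow≈ : firstBelow B ≈[≤ k ] rhsCoeff (false ∷ z)
    firstBelow≈ k′ k′≤k i j = begin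
      firstBelow B k′ i j               ≡⟨ +-identityʳ _ ⟨
      firstBelow B k′ i j + 0           ≡⟨ ≡.cong (firstBelow B k′ i j +_) firstAt-vanishes ⟨
      (firstBelow B ⊕ firstAt B) k′ i j ≡⟨ ≈-trans (rhs≤-zeros B) (positive-split-first B) k′ i j ⟨
      rhs≤ (suc B) (false ∷ z) k′ i j   ≡⟨ rhs≤-truncate (false ∷ z) k<B+1 k′ k′≤k i j ⟩
      rhsCoeff (false ∷ z) k′ i j       ∎
      where
      firstAt-vanishes : firstAt B k′ i j ≡ 0
      firstAt-vanishes = ≡.trans
        (ΣL-cong-at (box B n) k′ i j λ δ → term-vanishes (map suc (B ∷ δ)) i j (here (s≤s (s≤s k′≤k))))
        (ΣL-0 (box B n) k′ i j)

  rhsCoeff-zeros : rhsCoeff (false ∷ z) ≈ geom ⊗ rhsCoeff (true ∷ z)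
  rhsCoeff-zeros = geom-⊗-unique (rhsCoeff (true ∷ z)) rhsCoeff-zeros-unfold

-- Running the recurrence

allZero⇒replicate : ∀ v → allZero v ≡ true → v ≡ replicate (length v) false
allZero⇒replicate []          _   = ≡.refl
allZero⇒replicate (false ∷ v) all0 = ≡.cong (false ∷_) (allZero⇒replicate v all0)

¬allZero⇒1≤ones : ∀ v → allZero v ≡ false → 1 ≤ ones v
¬allZero⇒1≤ones (true  ∷ v) _     = s≤s z≤n
¬allZero⇒1≤ones (false ∷ v) ¬all0 = ¬allZero⇒1≤ones v ¬all0

-- An all-zero word is first rewritten to 10…0 of the same length, at the cost of one more unit of fuel.
fuelNeeded : List Bool → ℕ
fuelNeeded v = if allZero v then suc (2 * length v) else 2 * length v

fuelNeeded≤ : ∀ v → fuelNeeded v ≤ suc (2 * length v)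
fuelNeeded≤ v with allZero v
... | true  = ≤-refl
... | false = n≤1+n _

fAux≈rhsCoeff : ∀ fuel v → fuelNeeded v ≤ fuel → fAux fuel v ≈ rhsCoeff v
fAux≈rhsCoeff zero       []      ()
fAux≈rhsCoeff zero       (b ∷ v) enough with allZero (b ∷ v)
... | true  with () ← enough
... | false with () ← enough
fAux≈rhsCoeff (suc fuel) []      _      = ≈-sym (≈-trans (⊕-identityʳ (term [])) (⊗-identityˡ 1S))
fAux≈rhsCoeff (suc fuel) (b ∷ v) enough with allZero (b ∷ v) in all0
... | true  = begin
  geom ⊗ fAux fuel (true ∷ z)   ≈⟨ ⊗-congˡ {geom} (fAux≈rhsCoeff fuel (true ∷ z) enough′) ⟩
  geom ⊗ rhsCoeff (true ∷ z)    ≈⟨ rhsCoeff-zeros (length v) ⟨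
  rhsCoeff (false ∷ z)          ≡⟨ ≡.cong rhsCoeff (allZero⇒replicate (b ∷ v) all0) ⟨
  rhsCoeff (b ∷ v)              ∎
  where
  open ≈-Reasoning
  z = replicate (length v) false
  enough′ : fuelNeeded (true ∷ z) ≤ fuel
  enough′ = ≡.subst (λ l → 2 * suc l ≤ fuel) (≡.sym (length-replicate (length v))) (s≤s⁻¹ enough)
... | false = ≈-trans
  (ΣL-cong-All (allWords-length m) λ w |w| →
    ⊗-congˡ {qS (m ∸ ones w) ⊗ P (b ∷ v) w} (fAux≈rhsCoeff fuel w (enough′ w |w|)))
  (≈-sym (rhsCoeff-step (b ∷ v)))
  where
  m = suc (length v) ∸ ones (b ∷ v)
  enough′ : ∀ w → length w ≡ m → fuelNeeded w ≤ fuel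
  enough′ w |w| = begin
    fuelNeeded w         ≤⟨ fuelNeeded≤ w ⟩
    suc (2 * length w)   ≤⟨ s≤s (*-monoʳ-≤ 2 (≡.subst (_≤ length v) (≡.sym |w|) m≤length)) ⟩
    suc (2 * length v)   ≤⟨ s≤s⁻¹ (≡.subst (_≤ suc fuel) (*-suc 2 (length v)) enough) ⟩
    fuel                 ∎
    where
    open ≤-Reasoning
    m≤length : m ≤ length v
    m≤length = ∸-monoʳ-≤ (suc (length v)) (¬allZero⇒1≤ones (b ∷ v) all0)

mainTheorem3 : (n : ℕ) (v : Vec Bool n) (k i j : ℕ) →
    f (toList v) k i j ≡ rhsCoeff (toList v) k i j
mainTheorem3 n v = fAux≈rhsCoeff (suc (2 * length (toList v))) (toList v) (fuelNeeded≤ (toList v))
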